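{- For any two distinct vertices $u,v$ of $\mathrm{PX}(3,2)$ there is an automorphism $\alpha$ of $\mathrm{PX}(3,2)$ with $\alpha\cdot u=v$ and $\alpha\cdot v=u$.
   Context: For integers $n\ge 3$ and $1\le k<n$, the Praeger–Xu graph $\mathrm{PX}(n,k)$ is the simple graph with vertex set $\mathbb Z_n\times\mathbb Z_2^k$; a vertex is written $(i,x)$ with $x=x_0x_1\cdots x_{k-1}$ a bitstring of length $k$. Two vertices $(i,x)$ and $(j,y)$ are adjacent if and only if (after possibly swapping the two vertices) $j=i+1$ in $\mathbb Z_n$ and $x=az_1\cdots z_{k-1}$, $y=z_1\cdots z_{k-1}b$ for some bits $a,b,z_1,\dots,z_{k-1}\in\mathbb Z_2$. -}

module Defs where

open import Data.Nat using (ℕ; suc)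
open import Data.Fin using (Fin)
open import Data.Bool using (Bool)
open import Data.Vec using (Vec; _∷_; _∷ʳ_)
open import Data.Product using (_×_; ∃-syntax; _,_; proj₁; proj₂)
open import Data.Sum using (_⊎_)
open import Relation.Binary.PropositionalEquality using (_≡_)
open import Function.Bundles using (_↔_; Inverse)

sucMod : ∀ {m} → Fin (suc m) → Fin (suc m)
sucMod {m} i = Data.Fin.fromℕ< (Data.Nat.DivMod.m%n<n (suc (Data.Fin.toℕ i)) (suc m))
  where import Data.Nat.DivMod

-- Vertex set of PX(n,k): ℤ_n × ℤ_2^k ; here n = suc m, k = suc l
PXVertex : ℕ → ℕ → Set
PXVertex m l = Fin (suc m) × Vec Bool (suc l)

PXArc : ∀ {m l} → PXVertex m l → PXVertex m l → Set
PXArc {m} {l} (i , x) (j , y) =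
  (j ≡ sucMod i) ×
  (∃[ a ] ∃[ b ] ∃[ z ] (x ≡ a ∷ z × y ≡ z ∷ʳ b))

PXAdj : ∀ {m l} → PXVertex m l → PXVertex m l → Set
PXAdj u v = PXArc u v ⊎ PXArc v u

record PXAut (m l : ℕ) : Set where
  field
    perm : PXVertex m l ↔ PXVertex m l
    preserves : ∀ u v →
      (PXAdj u v → PXAdj (Inverse.to perm u) (Inverse.to perm v)) ×
      (PXAdj (Inverse.to perm u) (Inverse.to perm v) → PXAdj u v)

_·_ : ∀ {m l} → PXAut m l → PXVertex m l → PXVertex m l
α · u = Inverse.to (PXAut.perm α) u

-- For every n, rotating ℤ_n, reflecting it (with the bit string reversed) and
-- adding a vector d ∈ ℤ₂ⁿ to the bits sitting at the two positions a vertex occupies are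
-- automorphisms of PX(n,2); together they generate ℤ₂ⁿ ⋊ Dₙ. In PX(3,2) a search through
-- these 48 automorphisms shows that they move a fixed vertex o to every vertex and swap o
-- with every other vertex. If β o = u and γ swaps o with β⁻¹ v, then β γ β⁻¹ swaps u and v.
module Submission where

open import Defs
open import Relation.Binary.PropositionalEquality
  using (_≡_; refl; sym; trans; cong; cong₂; subst₂; module ≡-Reasoning)
open import Relation.Nullary using (¬_; ¬?; Dec; map′; _×-dec_; _→-dec_)
open import Relation.Nullary.Decidable using (toWitness)
open import Relation.Unary using (Pred; Decidable)
open import Relation.Binary using (DecidableEquality)
open import Data.Product using (∃-syntax; _×_; _,_; proj₁; proj₂)
open import Data.Product.Properties using () renaming (≡-dec to ×-≡-dec)
open import Data.Sum using (inj₁; inj₂)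
open import Data.Nat using (ℕ; zero; suc; s<s)
open import Data.Nat.DivMod using (_%_; n%n≡0; m<n⇒m%n≡m)
open import Data.Bool using (Bool; true; false; _xor_)
open import Data.Bool.Properties using (not-involutive) renaming (_≟_ to _≟ᵇ_)
open import Data.Fin using (Fin; zero; suc; toℕ; fromℕ; inject₁; opposite; _≟_)
open import Data.Fin.Properties
  using (toℕ-injective; toℕ-fromℕ<; toℕ-fromℕ; toℕ-inject₁; toℕ<n; opposite-involutive)
open import Data.Fin.Relation.Unary.Top using (view; ‵fromℕ; ‵inject₁)
open import Data.Vec using (Vec; []; _∷_; lookup)
open import Data.Vec.Properties using () renaming (≡-dec to vec-≡-dec)
open import Data.List
  using (List; []; _∷_; cartesianProduct; cartesianProductWith; iterate; allFin; _++_)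
open import Data.List.Membership.Propositional using (_∈_)
open import Data.List.Membership.Propositional.Properties
  using (∈-allFin; ∈-cartesianProduct⁺; ∈-cartesianProductWith⁺)
open import Data.List.Relation.Unary.Any using (Any; here; there; any?; satisfied)
open import Data.List.Relation.Unary.All as All using (all?)
open import Function using (_∘_)
open import Function.Bundles using (Inverse; mk↔ₛ′)
open import Function.Construct.Identity using (↔-id)
open import Function.Construct.Composition using (_↔-∘_)
open import Function.Construct.Symmetry using (↔-sym)

private
  variable
    m l : ℕ

sucMod-fromℕ : ∀ m → sucMod (fromℕ m) ≡ zero
sucMod-fromℕ m = toℕ-injective (begin
  toℕ (sucMod (fromℕ m))      ≡⟨ toℕ-fromℕ< _ ⟩
  suc (toℕ (fromℕ m)) % suc m ≡⟨ cong (λ k → suc k % suc m) (toℕ-fromℕ m) ⟩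
  suc m % suc m               ≡⟨ n%n≡0 (suc m) ⟩
  0                           ∎)
  where open ≡-Reasoning

sucMod-inject₁ : (i : Fin m) → sucMod (inject₁ i) ≡ suc i
sucMod-inject₁ {m} i = toℕ-injective (begin
  toℕ (sucMod (inject₁ i))      ≡⟨ toℕ-fromℕ< _ ⟩
  suc (toℕ (inject₁ i)) % suc m ≡⟨ cong (λ k → suc k % suc m) (toℕ-inject₁ i) ⟩
  suc (toℕ i) % suc m           ≡⟨ m<n⇒m%n≡m (s<s (toℕ<n i)) ⟩
  suc (toℕ i)                   ∎)
  where open ≡-Reasoning

predMod : Fin (suc m) → Fin (suc m)
predMod {m} zero = fromℕ m
predMod (suc i)  = inject₁ i

sucMod-predMod : (i : Fin (suc m)) → sucMod (predMod i) ≡ i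
sucMod-predMod {m} zero = sucMod-fromℕ m
sucMod-predMod (suc i)  = sucMod-inject₁ i

predMod-sucMod : (i : Fin (suc m)) → predMod (sucMod i) ≡ i
predMod-sucMod {m} i with view i
... | ‵fromℕ     rewrite sucMod-fromℕ m = refl
... | ‵inject₁ j rewrite sucMod-inject₁ j = refl

opposite-fromℕ : ∀ m → opposite (fromℕ m) ≡ zero
opposite-fromℕ zero    = refl
opposite-fromℕ (suc m) = cong inject₁ (opposite-fromℕ m)

opposite-inject₁ : (i : Fin m) → opposite (inject₁ i) ≡ suc (opposite i)
opposite-inject₁ zero    = refl
opposite-inject₁ (suc i) = cong inject₁ (opposite-inject₁ i)

sucMod-opposite-sucMod : (i : Fin (suc m)) → sucMod (opposite (sucMod i)) ≡ opposite i
sucMod-opposite-sucMod {m} i with view i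
... | ‵fromℕ     rewrite sucMod-fromℕ m | opposite-fromℕ m = sucMod-fromℕ m
... | ‵inject₁ j rewrite sucMod-inject₁ j | opposite-inject₁ j = sucMod-inject₁ (opposite j)

PXAdj-sym : {u v : PXVertex m l} → PXAdj u v → PXAdj v u
PXAdj-sym (inj₁ a) = inj₂ a
PXAdj-sym (inj₂ a) = inj₁ a

PreservesAdj : (PXVertex m l → PXVertex m l) → Set
PreservesAdj f = ∀ u v → PXAdj u v → PXAdj (f u) (f v)

arcs⇒PreservesAdj : (f : PXVertex m l → PXVertex m l) →
                    (∀ u v → PXArc u v → PXAdj (f u) (f v)) → PreservesAdj f
arcs⇒PreservesAdj f arc u v (inj₁ uv) = arc u v uv
arcs⇒PreservesAdj f arc u v (inj₂ vu) = PXAdj-sym (arc v u vu)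

mkPXAut : (f g : PXVertex m l → PXVertex m l) →
          (∀ u → f (g u) ≡ u) → (∀ u → g (f u) ≡ u) →
          PreservesAdj f → PreservesAdj g → PXAut m l
mkPXAut f g fg gf f-adj g-adj = record
  { perm      = mk↔ₛ′ f g fg gf
  ; preserves = λ u v → f-adj u v , subst₂ PXAdj (gf u) (gf v) ∘ g-adj (f u) (f v)
  }

idᴬ : PXAut m l
idᴬ = record { perm = ↔-id _ ; preserves = λ _ _ → (λ a → a) , (λ a → a) }

_∘ᴬ_ : PXAut m l → PXAut m l → PXAut m l
α ∘ᴬ β = record
  { perm      = PXAut.perm α ↔-∘ PXAut.perm β
  ; preserves = λ u v →
      proj₁ (PXAut.preserves α (β · u) (β · v)) ∘ proj₁ (PXAut.preserves β u v) ,
      proj₂ (PXAut.preserves β u v) ∘ proj₂ (PXAut.preserves α (β · u) (β · v))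
  }

infix 30 _⁻¹ᴬ
_⁻¹ᴬ : PXAut m l → PXAut m l
α ⁻¹ᴬ = record
  { perm      = ↔-sym (PXAut.perm α)
  ; preserves = λ u v →
      proj₂ (PXAut.preserves α (from u) (from v)) ∘ subst₂ PXAdj (sym (to∘from u)) (sym (to∘from v)) ,
      subst₂ PXAdj (to∘from u) (to∘from v) ∘ proj₁ (PXAut.preserves α (from u) (from v))
  }
  where
  open Inverse (PXAut.perm α) using (from) renaming (strictlyInverseˡ to to∘from)

rotate : PXVertex m l → PXVertex m l
rotate (i , x) = sucMod i , x

unrotate : PXVertex m l → PXVertex m l
unrotate (i , x) = predMod i , x

rotation : PXAut m l
rotation = mkPXAut rotate unrotate
  (λ (i , x) → cong (_, x) (sucMod-predMod i))
  (λ (i , x) → cong (_, x) (predMod-sucMod i))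
  (arcs⇒PreservesAdj rotate λ { _ _ (refl , arc) → inj₁ (refl , arc) })
  (arcs⇒PreservesAdj unrotate λ { (i , _) _ (refl , arc) →
     inj₁ (trans (predMod-sucMod i) (sym (sucMod-predMod i)) , arc) })

-- opposite j = −1 − j, so the positions i, i + 1 of a vertex go to −i − 1, −i − 2.
reflect : PXVertex m 1 → PXVertex m 1
reflect (i , a ∷ b ∷ []) = opposite (sucMod i) , b ∷ a ∷ []

reflect-involutive : (u : PXVertex m 1) → reflect (reflect u) ≡ u
reflect-involutive (i , a ∷ b ∷ []) =
  cong (_, a ∷ b ∷ []) (trans (cong opposite (sucMod-opposite-sucMod i)) (opposite-involutive i))

reflect-arc : (u v : PXVertex m 1) → PXArc u v → PXArc (reflect v) (reflect u)
reflect-arc (i , _) _ (refl , a , b , c ∷ [] , refl , refl) =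
  sym (sucMod-opposite-sucMod (sucMod i)) , b , a , c ∷ [] , refl , refl

reflection : PXAut m 1
reflection = mkPXAut reflect reflect reflect-involutive reflect-involutive adj adj
  where
  adj : PreservesAdj reflect
  adj = arcs⇒PreservesAdj reflect λ u v → inj₂ ∘ reflect-arc u v

xor-involutive : ∀ x y → x xor (x xor y) ≡ y
xor-involutive false y = refl
xor-involutive true  y = not-involutive y

-- A vertex (i , a ∷ b ∷ []) carries the bits a, b at the positions i, i + 1 of ℤ_n.
flip : Vec Bool (suc m) → PXVertex m 1 → PXVertex m 1
flip d (i , a ∷ b ∷ []) = i , (lookup d i xor a) ∷ (lookup d (sucMod i) xor b) ∷ []

flip-involutive : (d : Vec Bool (suc m)) (u : PXVertex m 1) → flip d (flip d u) ≡ u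
flip-involutive d (i , a ∷ b ∷ []) =
  cong₂ (λ a′ b′ → i , a′ ∷ b′ ∷ []) (xor-involutive (lookup d i) a) (xor-involutive (lookup d (sucMod i)) b)

flip-arc : (d : Vec Bool (suc m)) (u v : PXVertex m 1) → PXArc u v → PXArc (flip d u) (flip d v)
flip-arc d (i , _) _ (refl , a , b , c ∷ [] , refl , refl) =
  refl , lookup d i xor a , lookup d (sucMod (sucMod i)) xor b , (lookup d (sucMod i) xor c) ∷ [] , refl , refl

flipping : Vec Bool (suc m) → PXAut m 1
flipping d = mkPXAut (flip d) (flip d) (flip-involutive d) (flip-involutive d) adj adj
  where
  adj : PreservesAdj (flip d)
  adj = arcs⇒PreservesAdj (flip d) λ u v → inj₁ ∘ flip-arc d u v

dihedral : List (PXAut m 1)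
dihedral {m} = iterate (rotation ∘ᴬ_) idᴬ (suc m) ++ iterate (rotation ∘ᴬ_) reflection (suc m)

bits : List Bool
bits = true ∷ false ∷ []

∈-bits : (b : Bool) → b ∈ bits
∈-bits true  = here refl
∈-bits false = there (here refl)

bitVectors : ∀ n → List (Vec Bool n)
bitVectors zero    = [] ∷ []
bitVectors (suc n) = cartesianProductWith _∷_ bits (bitVectors n)

∈-bitVectors : ∀ {n} (x : Vec Bool n) → x ∈ bitVectors n
∈-bitVectors []      = here refl
∈-bitVectors (b ∷ x) = ∈-cartesianProductWith⁺ _∷_ (∈-bits b) (∈-bitVectors x)

pxGroup : List (PXAut m 1)
pxGroup {m} = cartesianProductWith (λ d ρ → flipping d ∘ᴬ ρ) (bitVectors (suc m)) dihedral

Swaps : PXVertex m l → PXVertex m l → Pred (PXAut m l) _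
Swaps u v α = α · u ≡ v × α · v ≡ u

·-⁻¹ᴬ : (α : PXAut m l) (u : PXVertex m l) → α · (α ⁻¹ᴬ · u) ≡ u
·-⁻¹ᴬ α = Inverse.strictlyInverseˡ (PXAut.perm α)

⁻¹ᴬ-· : (α : PXAut m l) (u : PXVertex m l) → α ⁻¹ᴬ · (α · u) ≡ u
⁻¹ᴬ-· α = Inverse.strictlyInverseʳ (PXAut.perm α)

swap-by-conjugation : (u₀ : PXVertex m l) →
  (∀ u → ∃[ β ] β · u₀ ≡ u) →
  (∀ w → ¬ u₀ ≡ w → ∃[ γ ] Swaps u₀ w γ) →
  ∀ u v → ¬ u ≡ v → ∃[ α ] Swaps u v α
swap-by-conjugation u₀ reach swap₀ u v u≢v with reach u
... | β , refl with swap₀ (β ⁻¹ᴬ · v) (λ u₀≡w → u≢v (trans (cong (β ·_) u₀≡w) (·-⁻¹ᴬ β v)))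
...   | γ , γu₀≡w , γw≡u₀ = β ∘ᴬ (γ ∘ᴬ β ⁻¹ᴬ) , αu≡v , αv≡u
  where
  open ≡-Reasoning
  αu≡v : β · (γ · (β ⁻¹ᴬ · (β · u₀))) ≡ v
  αu≡v = begin
    β · (γ · (β ⁻¹ᴬ · (β · u₀))) ≡⟨ cong (λ w → β · (γ · w)) (⁻¹ᴬ-· β u₀) ⟩
    β · (γ · u₀)                 ≡⟨ cong (β ·_) γu₀≡w ⟩
    β · (β ⁻¹ᴬ · v)              ≡⟨ ·-⁻¹ᴬ β v ⟩
    v                            ∎
  αv≡u : β · (γ · (β ⁻¹ᴬ · v)) ≡ β · u₀
  αv≡u = cong (β ·_) γw≡u₀

vertices : ∀ m l → List (PXVertex m l)
vertices m l = cartesianProduct (allFin (suc m)) (bitVectors (suc l))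

∈-vertices : (u : PXVertex m l) → u ∈ vertices m l
∈-vertices (i , x) = ∈-cartesianProduct⁺ (∈-allFin i) (∈-bitVectors x)

all-vertices? : ∀ {p} {P : Pred (PXVertex m l) p} → Decidable P → Dec (∀ u → P u)
all-vertices? {m} {l} P? =
  map′ (λ all u → All.lookup all (∈-vertices u)) (λ ∀P → All.tabulate (λ {u} _ → ∀P u))
       (all? P? (vertices m l))

infix 4 _≟ᵛ_
_≟ᵛ_ : DecidableEquality (PXVertex m l)
_≟ᵛ_ = ×-≡-dec _≟_ (vec-≡-dec _≟ᵇ_)

origin : PXVertex 2 1
origin = zero , false ∷ false ∷ []

PX[3,2]-reach-origin : (u : PXVertex 2 1) → Any (λ β → β · origin ≡ u) pxGroup
PX[3,2]-reach-origin = toWitness {a? = all-vertices? λ u → any? (λ β → β · origin ≟ᵛ u) pxGroup} _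

PX[3,2]-swap-origin : (w : PXVertex 2 1) → ¬ origin ≡ w → Any (Swaps origin w) pxGroup
PX[3,2]-swap-origin = toWitness {a? = all-vertices? λ w →
  ¬? (origin ≟ᵛ w) →-dec any? (λ γ → (γ · origin ≟ᵛ w) ×-dec (γ · w ≟ᵛ origin)) pxGroup} _

lemma5p4 : (u v : PXVertex 2 1) → ¬ (u ≡ v) →
    ∃[ α ] ((α · u ≡ v) × (α · v ≡ u))
lemma5p4 = swap-by-conjugation origin
  (satisfied ∘ PX[3,2]-reach-origin)
  (λ w → satisfied ∘ PX[3,2]-swap-origin w)
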